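{- Let $G$ be a graph which is not a star. Then $$\gamma_s(G^{\frac{1}{2}})\leq \min\{|E(G)|,\,|V(G)|\}.$$
   Context: All graphs are finite and simple. For a graph $G=(V,E)$, a set $D\subseteq V$ is a dominating set if every vertex of $V\setminus D$ is adjacent to at least one vertex of $D$. A dominating set $D$ is a secure dominating set if for every $u\in V\setminus D$ there exists $v\in D$ with $uv\in E$ such that $(D\setminus\{v\})\cup\{u\}$ is a dominating set of $G$. The secure domination number $\gamma_s(G)$ is the minimum cardinality of a secure dominating set of $G$. For $k\in\mathbb{N}$, the $k$-subdivision $G^{\frac{1}{k}}$ is the graph obtained from $G$ by replacing each edge $v_iv_j$ of $G$ by a path of length $k$ (with $k-1$ new internal vertices) joining $v_i$ and $v_j$. A star is a graph $K_{1,m}$. -}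

module Defs where

open import Data.Nat using (ℕ; _≤_; _⊓_)
open import Data.Fin using (Fin) renaming (_<_ to _<ᶠ_)
open import Data.Product using (Σ; ∃; ∃-syntax; _×_; _,_; proj₁; proj₂)
open import Data.Sum using (_⊎_; inj₁; inj₂)
open import Data.Empty using (⊥)
open import Data.List using (List; length; lookup)
open import Data.List.Membership.Propositional using (_∈_)
open import Data.List.Relation.Unary.All using (All)
open import Data.List.Relation.Unary.Unique.Propositional using (Unique)
open import Relation.Nullary using (¬_)
open import Relation.Binary.PropositionalEquality using (_≡_; _≢_)

module _ {V : Set} (Adj : V → V → Set) where

  IsDominating : (V → Set) → Set
  IsDominating S = ∀ x → ¬ S x → ∃[ y ] (S y × Adj x y)

  swapSet : List V → V → V → V → Set
  swapSet D v u x = (x ≡ u) ⊎ ((x ∈ D) × (x ≢ v))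

  IsSecureDominating : List V → Set
  IsSecureDominating D =
    IsDominating (_∈ D) ×
    (∀ u → ¬ (u ∈ D) →
      ∃[ v ] ((v ∈ D) × Adj u v × IsDominating (swapSet D v u)))

  SecDomNumber≤ : ℕ → Set
  SecDomNumber≤ k = ∃[ D ] (IsSecureDominating D × length D ≤ k)

  data Reachable : V → V → Set where
    here  : ∀ {x} → Reachable x x
    there : ∀ {x y z} → Adj x y → Reachable y z → Reachable x z

  IsConnected : Set
  IsConnected = ∀ x y → Reachable x y

-- Finite simple graphs: vertices Fin n, each edge stored once as (i , j)
-- with i < j, no repeated edges.

record Graph : Set where
  field
    n       : ℕ
    edges   : List (Fin n × Fin n)
    ordered : All (λ e → proj₁ e <ᶠ proj₂ e) edges
    unique  : Unique edges

module _ (G : Graph) where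
  open Graph G

  numV : ℕ
  numV = n

  numE : ℕ
  numE = length edges

  Adj : Fin n → Fin n → Set
  Adj i j = ((i , j) ∈ edges) ⊎ ((j , i) ∈ edges)

  -- G is a star K_{1,m} (m ≥ 0): some centre c is adjacent to every other
  -- vertex and every edge contains c.
  IsStar : Set
  IsStar = ∃[ c ] ((∀ v → v ≢ c → Adj c v) ×
                   All (λ e → (proj₁ e ≡ c) ⊎ (proj₂ e ≡ c)) edges)

  -- The 2-subdivision G^{1/2}: original vertices plus one vertex per edge.
  SubV : Set
  SubV = Fin n ⊎ Fin numE

  Incident : Fin n → Fin numE → Set
  Incident v k = (v ≡ proj₁ (lookup edges k)) ⊎ (v ≡ proj₂ (lookup edges k))

  SubAdj : SubV → SubV → Set
  SubAdj (inj₁ v) (inj₂ k) = Incident v k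
  SubAdj (inj₂ k) (inj₁ v) = Incident v k
  SubAdj _        _        = ⊥

{-# OPTIONS --safe #-}
module Submission where

-- Both the original vertices and the subdivision vertices form secure dominating sets of
-- G^{1/2}. For the vertices, a subdivision vertex on an edge ab is traded for a, and every
-- other subdivision vertex keeps an endpoint different from a. For the subdivision vertices,
-- an original vertex v can be traded for an edge k at v as long as every other vertex keeps
-- an edge besides k. If no edge at v qualifies, every edge at v is the only edge of some
-- other vertex; in a connected graph this forces every vertex to be v or a leaf hanging
-- on v, i.e. G is a star centred at v.

open import Defs
open import Data.Nat using (_⊓_)
open import Data.Nat.Properties using (⊓-sel; ≤-reflexive)
open import Data.Fin using (Fin; _≟_)
open import Data.Fin.Properties using (any?; all?; ¬∀⟶∃¬; <⇒≢)
open import Data.Product using (∃-syntax; _×_; _,_; proj₁; proj₂; map₂)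
open import Data.Sum using (_⊎_; inj₁; inj₂)
import Data.Sum as Sum
open import Data.Sum.Properties using (inj₁-injective; inj₂-injective)
open import Data.Empty using (⊥-elim)
open import Data.List using (List; lookup; tabulate)
open import Data.List.Properties using (length-tabulate)
open import Data.List.Membership.Propositional using (_∈_)
open import Data.List.Membership.Propositional.Properties using (∈-lookup; ∈-tabulate⁺; ∈-tabulate⁻)
import Data.List.Relation.Unary.All as All
import Data.List.Relation.Unary.Any as Any
open import Data.List.Relation.Unary.Any.Properties using (lookup-index)
open import Function using (_∘_)
open import Relation.Nullary using (¬_; Dec; yes; no)
open import Relation.Nullary.Decidable using (_⊎-dec_; _×-dec_; _→-dec_; ¬?)
open import Relation.Binary.PropositionalEquality using (_≡_; _≢_; refl; sym; trans; cong)

module _ (G : Graph) where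
  open Graph G

  incident? : ∀ v k → Dec (Incident G v k)
  incident? v k = (v ≟ proj₁ (lookup edges k)) ⊎-dec (v ≟ proj₂ (lookup edges k))

  Adj⇒≢ : ∀ {x y} → Adj G x y → x ≢ y
  Adj⇒≢ (inj₁ xy∈) = <⇒≢ (All.lookup ordered xy∈)
  Adj⇒≢ (inj₂ yx∈) = <⇒≢ (All.lookup ordered yx∈) ∘ sym

  Adj⇒common-edge : ∀ {x y} → Adj G x y → ∃[ k ] (Incident G x k × Incident G y k)
  Adj⇒common-edge (inj₁ xy∈) =
    Any.index xy∈ , inj₁ (cong proj₁ (lookup-index xy∈)) , inj₂ (cong proj₂ (lookup-index xy∈))
  Adj⇒common-edge (inj₂ yx∈) =
    Any.index yx∈ , inj₂ (cong proj₂ (lookup-index yx∈)) , inj₁ (cong proj₁ (lookup-index yx∈))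

  common-edge⇒Adj : ∀ {x y} k → Incident G x k → Incident G y k → x ≢ y → Adj G x y
  common-edge⇒Adj k (inj₁ refl) (inj₁ refl) x≢y = ⊥-elim (x≢y refl)
  common-edge⇒Adj k (inj₁ refl) (inj₂ refl) _   = inj₁ (∈-lookup k)
  common-edge⇒Adj k (inj₂ refl) (inj₁ refl) _   = inj₂ (∈-lookup k)
  common-edge⇒Adj k (inj₂ refl) (inj₂ refl) x≢y = ⊥-elim (x≢y refl)

  at-most-two-endpoints : ∀ {a b c} k → Incident G a k → Incident G b k → a ≢ b →
                          Incident G c k → c ≢ b → c ≡ a
  at-most-two-endpoints k (inj₁ refl) (inj₁ refl) a≢b _           _   = ⊥-elim (a≢b refl)
  at-most-two-endpoints k (inj₁ refl) (inj₂ refl) _   (inj₁ refl) _   = refl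
  at-most-two-endpoints k (inj₁ refl) (inj₂ refl) _   (inj₂ refl) c≢b = ⊥-elim (c≢b refl)
  at-most-two-endpoints k (inj₂ refl) (inj₁ refl) _   (inj₁ refl) c≢b = ⊥-elim (c≢b refl)
  at-most-two-endpoints k (inj₂ refl) (inj₁ refl) _   (inj₂ refl) _   = refl
  at-most-two-endpoints k (inj₂ refl) (inj₂ refl) a≢b _           _   = ⊥-elim (a≢b refl)

  other-endpoint : ∀ k a → ∃[ b ] (Incident G b k × b ≢ a)
  other-endpoint k a with proj₁ (lookup edges k) ≟ a
  ... | no  a₁≢a  = proj₁ (lookup edges k) , inj₁ refl , a₁≢a
  ... | yes refl = proj₂ (lookup edges k) , inj₂ refl , Adj⇒≢ (inj₁ (∈-lookup k)) ∘ sym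

  connected⇒non-isolated : IsConnected (Adj G) → ∀ {x y} → x ≢ y → ∃[ k ] Incident G x k
  connected⇒non-isolated connected {x} {y} x≢y with connected x y
  ... | here        = ⊥-elim (x≢y refl)
  ... | there x~z _ = proj₁ (Adj⇒common-edge x~z) , proj₁ (proj₂ (Adj⇒common-edge x~z))

  vertexSet : List (SubV G)
  vertexSet = tabulate inj₁

  edgeSet : List (SubV G)
  edgeSet = tabulate inj₂

  ∈-vertexSet : ∀ v → inj₁ v ∈ vertexSet
  ∈-vertexSet = ∈-tabulate⁺

  ∈-edgeSet : ∀ k → inj₂ k ∈ edgeSet
  ∈-edgeSet = ∈-tabulate⁺

  vertexSet-dominating : IsDominating (SubAdj G) (_∈ vertexSet)
  vertexSet-dominating (inj₁ v) v∉ = ⊥-elim (v∉ (∈-vertexSet v))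
  vertexSet-dominating (inj₂ k) _  = inj₁ (proj₁ (lookup edges k)) , ∈-vertexSet _ , inj₁ refl

  vertexSet-swap-dominating : ∀ k →
    IsDominating (SubAdj G) (swapSet (SubAdj G) vertexSet (inj₁ (proj₁ (lookup edges k))) (inj₂ k))
  vertexSet-swap-dominating k (inj₁ w) w∉ with w ≟ proj₁ (lookup edges k)
  ... | yes refl = inj₂ k , inj₁ refl , inj₁ refl
  ... | no  w≢a  = ⊥-elim (w∉ (inj₂ (∈-vertexSet w , w≢a ∘ inj₁-injective)))
  vertexSet-swap-dominating k (inj₂ k′) _ with other-endpoint k′ (proj₁ (lookup edges k))
  ... | b , b∈k′ , b≢a = inj₁ b , inj₂ (∈-vertexSet b , b≢a ∘ inj₁-injective) , b∈k′

  vertexSet-secure : IsSecureDominating (SubAdj G) vertexSet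
  vertexSet-secure = vertexSet-dominating , λ where
    (inj₁ v) v∉ → ⊥-elim (v∉ (∈-vertexSet v))
    (inj₂ k) _  → inj₁ _ , ∈-vertexSet _ , inj₁ refl , vertexSet-swap-dominating k

  HasOtherEdge : Fin n → Fin (numE G) → Set
  HasOtherEdge w k = ∃[ k′ ] (k′ ≢ k × Incident G w k′)

  -- Vacuously true for an isolated w; connectivity excludes this in neighbour-of-centre-is-leaf.
  OnlyEdge : Fin n → Fin (numE G) → Set
  OnlyEdge w k = ∀ k′ → Incident G w k′ → k′ ≡ k

  Swappable : Fin n → Fin (numE G) → Set
  Swappable v k = Incident G v k × (∀ w → w ≢ v → HasOtherEdge w k)

  edgeSet-swap-dominating : ∀ {v k} → Swappable v k →
    IsDominating (SubAdj G) (swapSet (SubAdj G) edgeSet (inj₂ k) (inj₁ v))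
  edgeSet-swap-dominating {v} (_ , others) (inj₁ w) w∉ with w ≟ v
  ... | yes refl = ⊥-elim (w∉ (inj₁ refl))
  ... | no  w≢v with others w w≢v
  ...   | k′ , k′≢k , w∈k′ = inj₂ k′ , inj₂ (∈-edgeSet k′ , k′≢k ∘ inj₂-injective) , w∈k′
  edgeSet-swap-dominating {v} {k} (v∈k , _) (inj₂ k′) k′∉ with k′ ≟ k
  ... | yes refl = inj₁ v , inj₁ refl , v∈k
  ... | no  k′≢k = ⊥-elim (k′∉ (inj₂ (∈-edgeSet k′ , k′≢k ∘ inj₂-injective)))

  edgeSet-dominating : (∀ v → ∃[ k ] Incident G v k) → IsDominating (SubAdj G) (_∈ edgeSet)
  edgeSet-dominating incidence (inj₁ v) _  = inj₂ (proj₁ (incidence v)) , ∈-edgeSet _ , proj₂ (incidence v)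
  edgeSet-dominating incidence (inj₂ k) k∉ = ⊥-elim (k∉ (∈-edgeSet k))

  edgeSet-secure : (∀ v → ∃[ k ] Swappable v k) → IsSecureDominating (SubAdj G) edgeSet
  edgeSet-secure swappable = edgeSet-dominating (map₂ proj₁ ∘ swappable) , λ where
    (inj₁ v) _  → let (k , sw) = swappable v in
                  inj₂ k , ∈-edgeSet k , proj₁ sw , edgeSet-swap-dominating sw
    (inj₂ k) k∉ → ⊥-elim (k∉ (∈-edgeSet k))

  hasOtherEdge? : ∀ w k → Dec (HasOtherEdge w k)
  hasOtherEdge? w k = any? λ k′ → ¬? (k′ ≟ k) ×-dec incident? w k′

  swappable? : ∀ v k → Dec (Swappable v k)
  swappable? v k = incident? v k ×-dec all? λ w → ¬? (w ≟ v) →-dec hasOtherEdge? w k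

  ¬HasOtherEdge⇒OnlyEdge : ∀ {w k} → ¬ HasOtherEdge w k → OnlyEdge w k
  ¬HasOtherEdge⇒OnlyEdge {k = k} ¬other k′ w∈k′ with k′ ≟ k
  ... | yes k′≡k = k′≡k
  ... | no  k′≢k = ⊥-elim (¬other (k′ , k′≢k , w∈k′))

  ¬Swappable⇒pendant : ∀ {v k} → Incident G v k → ¬ Swappable v k →
                       ∃[ w ] (w ≢ v × OnlyEdge w k)
  ¬Swappable⇒pendant {v} {k} v∈k ¬sw
    with ¬∀⟶∃¬ n _ (λ w → ¬? (w ≟ v) →-dec hasOtherEdge? w k) (λ others → ¬sw (v∈k , others))
  ... | w , ¬[w≢v⇒other] =
    w , (λ w≡v → ¬[w≢v⇒other] (λ w≢v → ⊥-elim (w≢v w≡v))) ,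
    ¬HasOtherEdge⇒OnlyEdge (λ other → ¬[w≢v⇒other] (λ _ → other))

  LeafOf : Fin n → Fin n → Set
  LeafOf v x = ∃[ k ] (Incident G v k × Incident G x k × x ≢ v × OnlyEdge x k)

  module _ (connected : IsConnected (Adj G)) (v : Fin n)
           (pendant : ∀ k → Incident G v k → ∃[ w ] (w ≢ v × OnlyEdge w k)) where

    neighbour-of-centre-is-leaf : ∀ {x} → Adj G x v → LeafOf v x
    neighbour-of-centre-is-leaf x~v with Adj⇒common-edge x~v
    ... | k , x∈k , v∈k with pendant k v∈k
    ... | w , w≢v , only with connected⇒non-isolated connected w≢v
    ... | k′ , w∈k′ with only k′ w∈k′
    ... | refl with at-most-two-endpoints k x∈k v∈k (Adj⇒≢ x~v) w∈k′ w≢v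
    ... | refl = k , v∈k , x∈k , w≢v , only

    neighbour-of-leaf-is-centre : ∀ {x y} → Adj G x y → LeafOf v y → x ≡ v
    neighbour-of-leaf-is-centre x~y (k₀ , v∈k₀ , _ , y≢v , only) with Adj⇒common-edge x~y
    ... | k , x∈k , y∈k with only k y∈k
    ... | refl = sym (at-most-two-endpoints k x∈k y∈k (Adj⇒≢ x~y) v∈k₀ (y≢v ∘ sym))

    centre-or-leaf : ∀ {x} → Reachable (Adj G) x v → x ≡ v ⊎ LeafOf v x
    centre-or-leaf here = inj₁ refl
    centre-or-leaf (there x~y y⇝v) with centre-or-leaf y⇝v
    ... | inj₁ refl = inj₂ (neighbour-of-centre-is-leaf x~y)
    ... | inj₂ leaf = inj₁ (neighbour-of-leaf-is-centre x~y leaf)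

    centre-on-every-edge : ∀ k → Incident G v k
    centre-on-every-edge k with centre-or-leaf (connected (proj₁ (lookup edges k)) v)
    ... | inj₁ a≡v = inj₁ (sym a≡v)
    ... | inj₂ (k₀ , v∈k₀ , _ , _ , only) with only k (inj₁ refl)
    ... | refl = v∈k₀

    pendant-edges⇒star : IsStar G
    pendant-edges⇒star = v , adjacent-to-all , All.tabulate on-centre
      where
      adjacent-to-all : ∀ u → u ≢ v → Adj G v u
      adjacent-to-all u u≢v with centre-or-leaf (connected u v)
      ... | inj₁ u≡v = ⊥-elim (u≢v u≡v)
      ... | inj₂ (k , v∈k , u∈k , _ , _) = common-edge⇒Adj k v∈k u∈k (u≢v ∘ sym)
      on-centre : ∀ {e} → e ∈ edges → proj₁ e ≡ v ⊎ proj₂ e ≡ v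
      on-centre e∈ rewrite lookup-index e∈ = Sum.map sym sym (centre-on-every-edge (Any.index e∈))

  swappable-edge : IsConnected (Adj G) → ¬ IsStar G → ∀ v → ∃[ k ] Swappable v k
  swappable-edge connected ¬star v with any? (swappable? v)
  ... | yes found = found
  ... | no  none  = ⊥-elim (¬star (pendant-edges⇒star connected v λ k v∈k →
                      ¬Swappable⇒pendant v∈k (λ sw → none (k , sw))))

theorem2p3 : (G : Graph) → IsConnected (Adj G) → ¬ IsStar G →
    SecDomNumber≤ (SubAdj G) (numE G ⊓ numV G)
theorem2p3 G connected ¬star with ⊓-sel (numE G) (numV G)
... | inj₁ ⊓≡m = edgeSet G , edgeSet-secure G (swappable-edge G connected ¬star) ,
                 ≤-reflexive (trans (length-tabulate inj₂) (sym ⊓≡m))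
... | inj₂ ⊓≡n = vertexSet G , vertexSet-secure G ,
                 ≤-reflexive (trans (length-tabulate inj₁) (sym ⊓≡n))
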